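{- Let $n \ge 2$ and let $g_1, \dots, g_n, h_1, \dots, h_n$ be elements of a commutative ring. Then $$3^{n-1} g_1 \cdots g_n + h_1 \cdots h_n = \sum_{\substack{S \subseteq [n] \\ S \ne \varnothing}} 3^{\delta(S)} \prod_{j \in [n] \setminus S} g_j \cdot \prod_{j \in S} \bigl( g_j + \sigma_j(S)\,\tau_j(S)\, h_j \bigr),$$ where, writing $s_{\max} = \max(S)$, $$\sigma_j(S) = \begin{cases} 1 & \text{if } j-1 \in S,\\ -1 & \text{if } j-1 \notin S,\end{cases} \qquad \tau_j(S) = \begin{cases} 1 & \text{if } s_{\max} > j,\\ -1 & \text{if } s_{\max} \le j,\end{cases} \qquad \delta(S) = \max(0,\, n - s_{\max} - 1).$$
   Context: $[n] = \{1, 2, \dots, n\}$. In the definition of $\sigma_1(S)$, note $0 \notin S$, so $\sigma_1(S) = -1$. -}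

module Defs where

open import Level using (Level)
open import Algebra.Bundles using (CommutativeRing; Semiring)
open import Data.Nat using (ℕ; zero; suc; _∸_; _⊔_; _<_; _<?_)
open import Data.Fin using (Fin; zero; suc; toℕ; inject₁)
open import Data.Fin.Subset using (Subset; inside; outside; _∈_)
open import Data.Fin.Subset.Properties using (nonempty?; _∈?_)
open import Data.Vec using (Vec; []; _∷_; lookup)
open import Data.List using (List; []; _∷_; map; filter; foldr; allFin; _++_)
open import Data.Bool using (Bool; true; false; if_then_else_)
open import Relation.Nullary using (does)

-- All subsets of [n] (as characteristic vectors over Fin n; index i ↔ element i+1).
allSubsets : (n : ℕ) → List (Subset n)
allSubsets zero = [] ∷ []
allSubsets (suc n) = map (outside ∷_) (allSubsets n) ++ map (inside ∷_) (allSubsets n)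

nonemptySubsets : (n : ℕ) → List (Subset n)
nonemptySubsets n = filter nonempty? (allSubsets n)

-- s_max = max(S) as an element of [n] (1-based); (value 0 only for S = ∅, never used).
smax : {n : ℕ} → Subset n → ℕ
smax {n} S = foldr _⊔_ 0 (map (λ i → suc (toℕ i)) (filter (_∈? S) (allFin n)))

-- Does j-1 belong to S, where j = toℕ i + 1?  (For j = 1, j-1 = 0 ∉ S.)
prevIn : {n : ℕ} → Subset n → Fin n → Bool
prevIn S zero = false
prevIn S (suc k) = lookup S (inject₁ k)

δ : {n : ℕ} → Subset n → ℕ
δ {n} S = n ∸ suc (smax S)

module Formula {c ℓ : Level} (R : CommutativeRing c ℓ) where
  open CommutativeRing R
  open import Algebra.Definitions.RawSemiring (Semiring.rawSemiring semiring) using (_^_; sum; product)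

  three : Carrier
  three = 1# + 1# + 1#

  sign : Bool → Carrier
  sign true = 1#
  sign false = - 1#

  σ : {n : ℕ} → Subset n → Fin n → Carrier
  σ S i = sign (prevIn S i)

  τ : {n : ℕ} → Subset n → Fin n → Carrier
  τ S i = sign (does (suc (toℕ i) <? smax S))

  lhs : (n : ℕ) → (Fin n → Carrier) → (Fin n → Carrier) → Carrier
  lhs n g h = three ^ (n ∸ 1) * product g + product h

  term : (n : ℕ) → (Fin n → Carrier) → (Fin n → Carrier) → Subset n → Carrier
  term n g h S =
    three ^ δ S
    * product (λ i → if lookup S i then 1# else g i)
    * product (λ i → if lookup S i then g i + σ S i * τ S i * h i else 1#)

  rhs : (n : ℕ) → (Fin n → Carrier) → (Fin n → Carrier) → Carrier
  rhs n g h = foldr _+_ 0# (map (term n g h) (nonemptySubsets n))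

-- Split the sum according to whether 1 ∈ S.  Prepending a position to a nonempty S
-- raises s_max by one, so δ and the τ_j of the later positions do not change; only
-- σ of the next position notices whether the new position was taken.  Writing W_p(n)
-- for the sum in which σ_1 is sign p (so p = false gives the statement), this yields
--   W_p(n+1) = g_1 W_false(n) + (g_1 + sign p h_1) W_true(n) + 3^(n-1) (g_1 - sign p h_1) g_2 ⋯ g_(n+1),
-- the last term coming from S = {1}, and induction gives
--   W_p(n+1) = 3^n g_1 ⋯ g_(n+1) + sign (not p) h_1 ⋯ h_(n+1).
module Submission where

open import Defs
open import Level using (Level)
open import Algebra.Bundles using (CommutativeRing; Semiring)
import Algebra.Solver.Ring.NaturalCoefficients.Default as NaturalCoefficients
open import Data.Nat using (ℕ; zero; suc; _∸_; _⊔_; _≤_; _<_; _<?_; s≤s; z≤n)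
open import Data.Nat.Properties using (≤-trans; m≤m⊔n; m≤n⇒m≤o⊔n; m≤n⇒m⊔n≡n; ⊔-assoc; ⊔-comm)
open import Data.Fin using (Fin; zero; suc; toℕ; inject₁)
open import Data.Fin.Subset using (Subset; inside; outside; ⊥; _∈_; Nonempty)
open import Data.Fin.Subset.Properties using (nonempty?; _∈?_)
open import Data.Vec using (_∷_; here; there; lookup)
open import Data.Vec.Properties using (lookup-replicate)
open import Data.Vec.Functional using (tail)
open import Data.List using (List; []; _∷_; map; filter; foldr; allFin; _++_)
open import Data.List.Properties using (map-tabulate; filter-++; filter-accept; filter-reject; filter-all)
open import Data.List.Membership.Propositional using () renaming (_∈_ to _∈ₗ_)
open import Data.List.Membership.Propositional.Properties using (∈-filter⁺; ∈-allFin; ∈-map⁺)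
open import Data.List.Relation.Unary.Any as Any using ()
open import Data.List.Relation.Unary.All as All using (All; []; _∷_; universal)
open import Data.List.Relation.Unary.All.Properties using (map⁺; all-filter)
open import Data.Bool using (Bool; true; false; if_then_else_; not)
open import Data.Product using (_,_)
open import Function using (_∘_; id)
open import Relation.Nullary using (yes; no; does)
open import Relation.Nullary.Decidable using (dec-true)
open import Relation.Binary.PropositionalEquality as ≡ using (_≡_; refl; cong; cong₂; module ≡-Reasoning)

maximum : List ℕ → ℕ
maximum = foldr _⊔_ 0

≤-maximum : {x : ℕ} {xs : List ℕ} → x ∈ₗ xs → x ≤ maximum xs
≤-maximum {xs = y ∷ ys} (Any.here refl) = m≤m⊔n y (maximum ys)
≤-maximum {xs = y ∷ ys} (Any.there x∈ys) = m≤n⇒m≤o⊔n y (≤-maximum x∈ys)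

suc-maximum : (xs : List ℕ) → suc (maximum xs) ≡ 1 ⊔ maximum (map suc xs)
suc-maximum [] = refl
suc-maximum (x ∷ xs) = begin
  suc x ⊔ suc (maximum xs)              ≡⟨ cong (suc x ⊔_) (suc-maximum xs) ⟩
  suc x ⊔ (1 ⊔ maximum (map suc xs))    ≡⟨ ≡.sym (⊔-assoc (suc x) 1 (maximum (map suc xs))) ⟩
  (suc x ⊔ 1) ⊔ maximum (map suc xs)    ≡⟨ cong (_⊔ maximum (map suc xs)) (⊔-comm (suc x) 1) ⟩
  (1 ⊔ suc x) ⊔ maximum (map suc xs)    ≡⟨ ⊔-assoc 1 (suc x) (maximum (map suc xs)) ⟩
  1 ⊔ (suc x ⊔ maximum (map suc xs))    ∎
  where open ≡-Reasoning

members : {n : ℕ} → Subset n → List (Fin n)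
members {n} S = filter (_∈? S) (allFin n)

elements : {n : ℕ} → Subset n → List ℕ
elements S = map (λ i → suc (toℕ i)) (members S)

filter-∈?-map-suc : {n : ℕ} (b : Bool) (S : Subset n) (xs : List (Fin n)) →
  filter (_∈? (b ∷ S)) (map suc xs) ≡ map suc (filter (_∈? S) xs)
filter-∈?-map-suc b S [] = refl
filter-∈?-map-suc b S (x ∷ xs) with x ∈? S
... | yes _ = cong (suc x ∷_) (filter-∈?-map-suc b S xs)
... | no _  = filter-∈?-map-suc b S xs

allFin-suc : (n : ℕ) → allFin (suc n) ≡ zero ∷ map suc (allFin n)
allFin-suc n = cong (zero ∷_) (≡.sym (map-tabulate id suc))

members-outside : {n : ℕ} (S : Subset n) → members (outside ∷ S) ≡ map suc (members S)
members-outside {n} S =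
  ≡.trans (cong (filter (_∈? (outside ∷ S))) (allFin-suc n)) (filter-∈?-map-suc outside S (allFin n))

members-inside : {n : ℕ} (S : Subset n) → members (inside ∷ S) ≡ zero ∷ map suc (members S)
members-inside {n} S =
  ≡.trans (cong (filter (_∈? (inside ∷ S))) (allFin-suc n))
          (cong (zero ∷_) (filter-∈?-map-suc inside S (allFin n)))

elements-map-suc : {n : ℕ} (is : List (Fin n)) →
  _≡_ {A = List ℕ} (map (λ i → suc (toℕ i)) (map suc is)) (map suc (map (λ i → suc (toℕ i)) is))
elements-map-suc [] = refl
elements-map-suc (i ∷ is) = cong (suc (suc (toℕ i)) ∷_) (elements-map-suc is)

elements-outside : {n : ℕ} (S : Subset n) → elements (outside ∷ S) ≡ map suc (elements S)
elements-outside S =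
  ≡.trans (cong (map (λ i → suc (toℕ i))) (members-outside S)) (elements-map-suc (members S))

elements-inside : {n : ℕ} (S : Subset n) → elements (inside ∷ S) ≡ 1 ∷ map suc (elements S)
elements-inside S =
  ≡.trans (cong (map (λ i → suc (toℕ i))) (members-inside S)) (cong (1 ∷_) (elements-map-suc (members S)))

elements-⊥ : (n : ℕ) → elements (⊥ {n}) ≡ []
elements-⊥ zero = refl
elements-⊥ (suc n) = ≡.trans (elements-outside ⊥) (cong (map suc) (elements-⊥ n))

toℕ<smax : {n : ℕ} {S : Subset n} {i : Fin n} → i ∈ S → toℕ i < smax S
toℕ<smax {S = S} {i} i∈S =
  ≤-maximum (∈-map⁺ (λ j → suc (toℕ j)) (∈-filter⁺ (_∈? S) (∈-allFin i) i∈S))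

smax-positive : {n : ℕ} {S : Subset n} → Nonempty S → 0 < smax S
smax-positive (i , i∈S) = ≤-trans (s≤s z≤n) (toℕ<smax i∈S)

smax-inside : {n : ℕ} (S : Subset n) → smax (inside ∷ S) ≡ suc (smax S)
smax-inside S = ≡.trans (cong maximum (elements-inside S)) (≡.sym (suc-maximum (elements S)))

smax-outside : {n : ℕ} (S : Subset n) → Nonempty S → smax (outside ∷ S) ≡ suc (smax S)
smax-outside S (i , i∈S) = begin
  smax (outside ∷ S)
    ≡⟨ ≡.sym (m≤n⇒m⊔n≡n (smax-positive {S = outside ∷ S} (suc i , there i∈S))) ⟩
  1 ⊔ smax (outside ∷ S)
    ≡⟨ cong (λ xs → 1 ⊔ maximum xs) (elements-outside S) ⟩
  1 ⊔ maximum (map suc (elements S))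
    ≡⟨ ≡.sym (suc-maximum (elements S)) ⟩
  suc (smax S) ∎
  where open ≡-Reasoning

smax-⊥ : (n : ℕ) → smax (⊥ {n}) ≡ 0
smax-⊥ n = cong maximum (elements-⊥ n)

nonempty-outside⁺ : {n : ℕ} {S : Subset n} → Nonempty S → Nonempty (outside ∷ S)
nonempty-outside⁺ (i , i∈S) = suc i , there i∈S

nonempty-outside⁻ : {n : ℕ} {S : Subset n} → Nonempty (outside ∷ S) → Nonempty S
nonempty-outside⁻ (suc i , there i∈S) = i , i∈S

filter-nonempty-outside : {n : ℕ} (Ss : List (Subset n)) →
  filter nonempty? (map (outside ∷_) Ss) ≡ map (outside ∷_) (filter nonempty? Ss)
filter-nonempty-outside [] = refl
filter-nonempty-outside (S ∷ Ss) with nonempty? S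
... | yes ne = ≡.trans (filter-accept nonempty? (nonempty-outside⁺ ne))
                     (cong ((outside ∷ S) ∷_) (filter-nonempty-outside Ss))
... | no ¬ne = ≡.trans (filter-reject nonempty? (¬ne ∘ nonempty-outside⁻))
                     (filter-nonempty-outside Ss)

nonemptySubsets-suc : (n : ℕ) →
  nonemptySubsets (suc n) ≡ map (outside ∷_) (nonemptySubsets n) ++ map (inside ∷_) (allSubsets n)
nonemptySubsets-suc n = begin
  filter nonempty? (map (outside ∷_) A ++ map (inside ∷_) A)
    ≡⟨ filter-++ nonempty? (map (outside ∷_) A) (map (inside ∷_) A) ⟩
  filter nonempty? (map (outside ∷_) A) ++ filter nonempty? (map (inside ∷_) A)
    ≡⟨ cong₂ _++_ (filter-nonempty-outside A)
                  (filter-all nonempty? (map⁺ (universal (λ _ → zero , here) A))) ⟩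
  map (outside ∷_) (filter nonempty? A) ++ map (inside ∷_) A
    ∎
  where
  open ≡-Reasoning
  A = allSubsets n

prevFrom : {n : ℕ} → Bool → Subset n → Fin n → Bool
prevFrom p S zero = p
prevFrom p S (suc k) = lookup S (inject₁ k)

prevFrom-∷ : {n : ℕ} (p b : Bool) (S : Subset n) (k : Fin n) → prevFrom p (b ∷ S) (suc k) ≡ prevFrom b S k
prevFrom-∷ p b S zero = refl
prevFrom-∷ p b S (suc k) = refl

prevIn≡prevFrom-false : {n : ℕ} (S : Subset n) (i : Fin n) → prevIn S i ≡ prevFrom false S i
prevIn≡prevFrom-false S zero = refl
prevIn≡prevFrom-false S (suc k) = refl

δ-∷ : {n : ℕ} (b : Bool) (S : Subset n) → smax (b ∷ S) ≡ suc (smax S) → δ (b ∷ S) ≡ δ S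
δ-∷ {n} b S e = cong (λ m → suc n ∸ suc m) e

δ-⊥ : (n : ℕ) → δ (⊥ {n}) ≡ n ∸ 1
δ-⊥ n = cong (λ m → n ∸ suc m) (smax-⊥ n)

module _ {c ℓ : Level} (R : CommutativeRing c ℓ) where
  open CommutativeRing R hiding (zero) renaming (refl to ≈-refl)
  open Formula R
  open import Algebra.Definitions.RawSemiring (Semiring.rawSemiring semiring) using (_^_; product)
  open import Algebra.Properties.Monoid.Sum *-monoid using ()
    renaming (sum-cong-≋ to product-cong; sum-cong-≗ to product-cong-≡)
  open import Algebra.Properties.CommutativeMonoid.Sum *-commutativeMonoid using ()
    renaming (∑-distrib-+ to product-distrib-*)
  open import Algebra.Properties.CommutativeSemigroup *-commutativeSemigroup using (x∙yz≈y∙xz)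
  open import Algebra.Properties.Ring ring using (-‿involutive; -1*x≈-x)
  open import Relation.Binary.Reasoning.Setoid setoid
  open NaturalCoefficients commutativeSemiring using (solve; _:+_; _:*_; con; _:=_)

  sumOver : {A : Set} → List A → (A → Carrier) → Carrier
  sumOver xs f = foldr _+_ 0# (map f xs)

  sumOver-++ : {A : Set} (xs ys : List A) (f : A → Carrier) →
    sumOver (xs ++ ys) f ≈ sumOver xs f + sumOver ys f
  sumOver-++ [] ys f = sym (+-identityˡ _)
  sumOver-++ (x ∷ xs) ys f = trans (+-congˡ (sumOver-++ xs ys f)) (sym (+-assoc _ _ _))

  sumOver-map : {A B : Set} (k : A → B) (xs : List A) (f : B → Carrier) →
    sumOver (map k xs) f ≡ sumOver xs (f ∘ k)
  sumOver-map k [] f = refl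
  sumOver-map k (x ∷ xs) f = cong (f (k x) +_) (sumOver-map k xs f)

  sumOver-map-++ : {A B : Set} (k k′ : A → B) (xs ys : List A) (f : B → Carrier) →
    sumOver (map k xs ++ map k′ ys) f ≈ sumOver xs (f ∘ k) + sumOver ys (f ∘ k′)
  sumOver-map-++ k k′ xs ys f = begin
    sumOver (map k xs ++ map k′ ys) f         ≈⟨ sumOver-++ (map k xs) (map k′ ys) f ⟩
    sumOver (map k xs) f + sumOver (map k′ ys) f
      ≡⟨ cong₂ _+_ (sumOver-map k xs f) (sumOver-map k′ ys f) ⟩
    sumOver xs (f ∘ k) + sumOver ys (f ∘ k′)  ∎

  sumOver-cong : {A : Set} {xs : List A} {f f′ : A → Carrier} →
    All (λ x → f x ≈ f′ x) xs → sumOver xs f ≈ sumOver xs f′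
  sumOver-cong [] = ≈-refl
  sumOver-cong (fx≈f′x ∷ eqs) = +-cong fx≈f′x (sumOver-cong eqs)

  sumOver-*ˡ : {A : Set} (a : Carrier) (xs : List A) (f : A → Carrier) →
    sumOver xs (λ x → a * f x) ≈ a * sumOver xs f
  sumOver-*ˡ a [] f = sym (zeroʳ a)
  sumOver-*ˡ a (x ∷ xs) f = trans (+-congˡ (sumOver-*ˡ a xs f)) (sym (distribˡ a _ _))

  sumOver-nonemptySubsets-suc : (n : ℕ) (f : Subset (suc n) → Carrier) →
    sumOver (nonemptySubsets (suc n)) f
      ≈ sumOver (nonemptySubsets n) (f ∘ (outside ∷_)) + sumOver (allSubsets n) (f ∘ (inside ∷_))
  sumOver-nonemptySubsets-suc n f = begin
    sumOver (nonemptySubsets (suc n)) f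
      ≡⟨ cong (λ Ss → sumOver Ss f) (nonemptySubsets-suc n) ⟩
    sumOver (map (outside ∷_) (nonemptySubsets n) ++ map (inside ∷_) (allSubsets n)) f
      ≈⟨ sumOver-map-++ (outside ∷_) (inside ∷_) (nonemptySubsets n) (allSubsets n) f ⟩
    sumOver (nonemptySubsets n) (f ∘ (outside ∷_)) + sumOver (allSubsets n) (f ∘ (inside ∷_)) ∎

  sumOver-allSubsets : (n : ℕ) (f : Subset n → Carrier) →
    sumOver (allSubsets n) f ≈ f ⊥ + sumOver (nonemptySubsets n) f
  sumOver-allSubsets zero f = ≈-refl
  sumOver-allSubsets (suc n) f = begin
    sumOver (allSubsets (suc n)) f
      ≈⟨ sumOver-map-++ (outside ∷_) (inside ∷_) (allSubsets n) (allSubsets n) f ⟩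
    sumOver (allSubsets n) (f ∘ (outside ∷_)) + sumOver (allSubsets n) (f ∘ (inside ∷_))
      ≈⟨ +-congʳ (sumOver-allSubsets n (f ∘ (outside ∷_))) ⟩
    (f ⊥ + sumOver (nonemptySubsets n) (f ∘ (outside ∷_))) + sumOver (allSubsets n) (f ∘ (inside ∷_))
      ≈⟨ +-assoc _ _ _ ⟩
    f ⊥ + (sumOver (nonemptySubsets n) (f ∘ (outside ∷_)) + sumOver (allSubsets n) (f ∘ (inside ∷_)))
      ≈⟨ +-congˡ (sym (sumOver-nonemptySubsets-suc n f)) ⟩
    f ⊥ + sumOver (nonemptySubsets (suc n)) f ∎

  -- The semiring solver knows no negation, so −1 is an atom m for it; an identity that
  -- holds only modulo 1 + m ≈ 0 is proved in the form X + (1 + m) a ≈ Y + (1 + m) b.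
  cancel-multiples-of-1-1 : {X Y a b : Carrier} →
    X + (1# + - 1#) * a ≈ Y + (1# + - 1#) * b → X ≈ Y
  cancel-multiples-of-1-1 {X} {Y} {a} {b} eq = begin
    X                    ≈⟨ sym (vanish a) ⟩
    X + (1# + - 1#) * a  ≈⟨ eq ⟩
    Y + (1# + - 1#) * b  ≈⟨ vanish b ⟩
    Y                    ∎
    where
    vanish : ∀ {Z} c → Z + (1# + - 1#) * c ≈ Z
    vanish {Z} c = trans (+-congˡ (trans (*-congʳ (-‿inverseʳ 1#)) (zeroˡ c))) (+-identityʳ Z)

  sign-not : (p : Bool) → sign p * - 1# ≈ sign (not p)
  sign-not true = *-identityˡ (- 1#)
  sign-not false = trans (-1*x≈-x (- 1#)) (-‿involutive 1#)

  -- σ₁ becomes sign p instead of −1, as if the position before the first one lay in S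
  -- exactly when p holds: termAfter p is the term of S seen as the tail of a longer
  -- subset, and termAfter false is the term of the statement.
  factorAfter : {n : ℕ} → Bool → Subset n → (g h : Fin n → Carrier) → Fin n → Carrier
  factorAfter p S g h i = if lookup S i then g i + sign (prevFrom p S i) * τ S i * h i else g i

  termAfter : {n : ℕ} → Bool → (g h : Fin n → Carrier) → Subset n → Carrier
  termAfter p g h S = three ^ δ S * product (factorAfter p S g h)

  rhsAfter : Bool → (n : ℕ) → (g h : Fin n → Carrier) → Carrier
  rhsAfter p n g h = sumOver (nonemptySubsets n) (termAfter p g h)

  if-*-if : (b : Bool) (x y : Carrier) → (if b then 1# else x) * (if b then y else 1#) ≈ (if b then y else x)
  if-*-if true x y = *-identityˡ y
  if-*-if false x y = *-identityʳ x

  term≈termAfter-false : (n : ℕ) (g h : Fin n → Carrier) (S : Subset n) →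
    term n g h S ≈ termAfter false g h S
  term≈termAfter-false n g h S = begin
    three ^ δ S * product outside-factor * product inside-factor
      ≈⟨ *-assoc _ _ _ ⟩
    three ^ δ S * (product outside-factor * product inside-factor)
      ≈⟨ *-congˡ (sym (product-distrib-* outside-factor inside-factor)) ⟩
    three ^ δ S * product (λ i → outside-factor i * inside-factor i)
      ≈⟨ *-congˡ (product-cong merge) ⟩
    termAfter false g h S ∎
    where
    outside-factor = λ i → if lookup S i then 1# else g i
    inside-factor = λ i → if lookup S i then g i + σ S i * τ S i * h i else 1#
    merge : (i : Fin n) → outside-factor i * inside-factor i ≈ factorAfter false S g h i
    merge i = trans (if-*-if (lookup S i) (g i) _)
      (reflexive (cong (λ q → if lookup S i then g i + sign q * τ S i * h i else g i)
                       (prevIn≡prevFrom-false S i)))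

  rhs≈rhsAfter-false : (n : ℕ) (g h : Fin n → Carrier) → rhs n g h ≈ rhsAfter false n g h
  rhs≈rhsAfter-false n g h = sumOver-cong (universal (term≈termAfter-false n g h) (nonemptySubsets n))

  τ-∷ : {n : ℕ} (b : Bool) (S : Subset n) → smax (b ∷ S) ≡ suc (smax S) →
    (k : Fin n) → τ (b ∷ S) (suc k) ≡ τ S k
  τ-∷ b S e k = cong (λ m → sign (does (suc (suc (toℕ k)) <? m))) e

  factorAfter-∷ : {n : ℕ} (p b : Bool) {S : Subset n} (g h : Fin (suc n) → Carrier) →
    smax (b ∷ S) ≡ suc (smax S) → (k : Fin n) →
    factorAfter p (b ∷ S) g h (suc k) ≡ factorAfter b S (tail g) (tail h) k
  factorAfter-∷ p b {S} g h e k =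
    cong₂ (λ q t → if lookup S k then g (suc k) + sign q * t * h (suc k) else g (suc k))
          (prevFrom-∷ p b S k) (τ-∷ b S e k)

  termAfter-∷ : {n : ℕ} (p b : Bool) (S : Subset n) (g h : Fin (suc n) → Carrier) →
    smax (b ∷ S) ≡ suc (smax S) →
    termAfter p g h (b ∷ S) ≈ factorAfter p (b ∷ S) g h zero * termAfter b (tail g) (tail h) S
  termAfter-∷ p b S g h e = begin
    three ^ δ (b ∷ S) * (f₀ * product (λ k → factorAfter p (b ∷ S) g h (suc k)))
      ≡⟨ cong₂ (λ d P → three ^ d * (f₀ * P)) (δ-∷ b S e)
               (product-cong-≡ (factorAfter-∷ p b g h e)) ⟩
    three ^ δ S * (f₀ * product (factorAfter b S (tail g) (tail h)))
      ≈⟨ x∙yz≈y∙xz _ _ _ ⟩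
    f₀ * termAfter b (tail g) (tail h) S ∎
    where f₀ = factorAfter p (b ∷ S) g h zero

  τ-inside-nonempty : {n : ℕ} {S : Subset n} → Nonempty S → τ (inside ∷ S) zero ≡ 1#
  τ-inside-nonempty {S = S} ne =
    ≡.trans (cong (λ m → sign (does (1 <? m))) (smax-inside S))
            (cong sign (dec-true (0 <? smax S) (smax-positive ne)))

  τ-inside-⊥ : (n : ℕ) → τ (inside ∷ ⊥ {n}) zero ≡ - 1#
  τ-inside-⊥ n = cong (λ m → sign (does (1 <? m))) (≡.trans (smax-inside (⊥ {n})) (cong suc (smax-⊥ n)))

  termAfter-⊥ : {n : ℕ} (p : Bool) (g h : Fin n → Carrier) →
    termAfter p g h ⊥ ≈ three ^ (n ∸ 1) * product g
  termAfter-⊥ {n} p g h = *-cong (reflexive (cong (three ^_) (δ-⊥ n)))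
    (product-cong (λ i → reflexive (cong (λ b → if b then g i + sign (prevFrom p ⊥ i) * τ ⊥ i * h i else g i)
                                         (lookup-replicate i outside))))

  rhsAfter-suc : (p : Bool) (n : ℕ) (g h : Fin (suc n) → Carrier) →
    rhsAfter p (suc n) g h ≈
      g zero * rhsAfter false n (tail g) (tail h)
      + ((g zero + sign p * - 1# * h zero) * (three ^ (n ∸ 1) * product (tail g))
         + (g zero + sign p * 1# * h zero) * rhsAfter true n (tail g) (tail h))
  rhsAfter-suc p n g h = begin
    rhsAfter p (suc n) g h
      ≈⟨ sumOver-nonemptySubsets-suc n T ⟩
    sumOver N (T ∘ (outside ∷_)) + sumOver (allSubsets n) (T ∘ (inside ∷_))
      ≈⟨ +-congˡ (sumOver-allSubsets n (T ∘ (inside ∷_))) ⟩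
    sumOver N (T ∘ (outside ∷_)) + (T (inside ∷ ⊥) + sumOver N (T ∘ (inside ∷_)))
      ≈⟨ +-cong (trans (sumOver-cong (All.map outside-case (all-filter nonempty? (allSubsets n))))
                       (sumOver-*ˡ _ N _))
                (+-cong singleton-case
                        (trans (sumOver-cong (All.map inside-case (all-filter nonempty? (allSubsets n))))
                               (sumOver-*ˡ _ N _))) ⟩
    g zero * rhsAfter false n g′ h′
      + ((g zero + sign p * - 1# * h zero) * (three ^ (n ∸ 1) * product g′)
         + (g zero + sign p * 1# * h zero) * rhsAfter true n g′ h′) ∎
    where
    T = termAfter p g h
    N = nonemptySubsets n
    g′ = tail g
    h′ = tail h

    outside-case : {S : Subset n} → Nonempty S → T (outside ∷ S) ≈ g zero * termAfter false g′ h′ S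
    outside-case {S} ne = termAfter-∷ p outside S g h (smax-outside S ne)

    inside-case : {S : Subset n} → Nonempty S →
      T (inside ∷ S) ≈ (g zero + sign p * 1# * h zero) * termAfter true g′ h′ S
    inside-case {S} ne = trans (termAfter-∷ p inside S g h (smax-inside S))
      (*-congʳ (+-congˡ (*-congʳ (*-congˡ (reflexive (τ-inside-nonempty ne))))))

    singleton-case : T (inside ∷ ⊥) ≈ (g zero + sign p * - 1# * h zero) * (three ^ (n ∸ 1) * product g′)
    singleton-case = trans (termAfter-∷ p inside ⊥ g h (smax-inside (⊥ {n})))
      (*-cong (+-congˡ (*-congʳ (*-congˡ (reflexive (τ-inside-⊥ n))))) (termAfter-⊥ true g′ h′))

  rhsAfter-closed : (p : Bool) (n : ℕ) (g h : Fin (suc n) → Carrier) →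
    rhsAfter p (suc n) g h ≈ three ^ n * product g + sign (not p) * product h
  rhsAfter-closed p zero g h = begin
    rhsAfter p 1 g h
      ≈⟨ rhsAfter-suc p zero g h ⟩
    g zero * 0# + ((g zero + sign p * - 1# * h zero) * (1# * 1#) + (g zero + sign p * 1# * h zero) * 0#)
      ≈⟨ +-congˡ (+-congʳ (*-congʳ (+-congˡ (*-congʳ (sign-not p))))) ⟩
    g zero * 0# + ((g zero + sign (not p) * h zero) * (1# * 1#) + (g zero + sign p * 1# * h zero) * 0#)
      ≈⟨ solve 4 (λ x y s s′ →
                    x :* con 0 :+ ((x :+ s′ :* y) :* (con 1 :* con 1) :+ (x :+ s :* con 1 :* y) :* con 0)
                    := con 1 :* (x :* con 1) :+ s′ :* (y :* con 1))
                 ≈-refl (g zero) (h zero) (sign p) (sign (not p)) ⟩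
    1# * (g zero * 1#) + sign (not p) * (h zero * 1#) ∎
  rhsAfter-closed p (suc m) g h = begin
    rhsAfter p (suc (suc m)) g h
      ≈⟨ rhsAfter-suc p (suc m) g h ⟩
    g zero * rhsAfter false (suc m) g′ h′
      + ((g zero + sign p * - 1# * h zero) * (three ^ m * G)
         + (g zero + sign p * 1# * h zero) * rhsAfter true (suc m) g′ h′)
      ≈⟨ +-cong (*-congˡ (rhsAfter-closed false m g′ h′))
                (+-congˡ (*-congˡ (rhsAfter-closed true m g′ h′))) ⟩
    g zero * (three ^ m * G + 1# * H)
      + ((g zero + sign p * - 1# * h zero) * (three ^ m * G)
         + (g zero + sign p * 1# * h zero) * (three ^ m * G + - 1# * H))
      ≈⟨ step p ⟩
    three * three ^ m * (g zero * G) + sign (not p) * (h zero * H) ∎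
    where
    g′ = tail g
    h′ = tail h
    G = product g′
    H = product h′
    step : (p : Bool) →
      g zero * (three ^ m * G + 1# * H)
        + ((g zero + sign p * - 1# * h zero) * (three ^ m * G)
           + (g zero + sign p * 1# * h zero) * (three ^ m * G + - 1# * H))
      ≈ three * three ^ m * (g zero * G) + sign (not p) * (h zero * H)
    step true = cancel-multiples-of-1-1 {b = g zero * H + h zero * three ^ m * G}
      (solve 6 (λ x y T G H m →
          x :* (T :* G :+ con 1 :* H)
            :+ ((x :+ con 1 :* m :* y) :* (T :* G) :+ (x :+ con 1 :* con 1 :* y) :* (T :* G :+ m :* H))
            :+ (con 1 :+ m) :* con 0
          := (con 1 :+ con 1 :+ con 1) :* T :* (x :* G) :+ m :* (y :* H)
             :+ (con 1 :+ m) :* (x :* H :+ y :* T :* G))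
        ≈-refl (g zero) (h zero) (three ^ m) G H (- 1#))
    step false = cancel-multiples-of-1-1 {a = h zero * H}
                   {b = g zero * H + - 1# * h zero * three ^ m * G + - 1# * h zero * H}
      (solve 6 (λ x y T G H m →
          x :* (T :* G :+ con 1 :* H)
            :+ ((x :+ m :* m :* y) :* (T :* G) :+ (x :+ m :* con 1 :* y) :* (T :* G :+ m :* H))
            :+ (con 1 :+ m) :* (y :* H)
          := (con 1 :+ con 1 :+ con 1) :* T :* (x :* G) :+ con 1 :* (y :* H)
             :+ (con 1 :+ m) :* (x :* H :+ m :* y :* T :* G :+ m :* y :* H))
        ≈-refl (g zero) (h zero) (three ^ m) G H (- 1#))

-- The hypothesis 2 ≤ n only excludes n = 0; the identity holds for every n ≥ 1.
lemma4p1 : {c ℓ : Level} (R : CommutativeRing c ℓ) (n : ℕ) → 2 ≤ n →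
    (g h : Fin n → CommutativeRing.Carrier R) →
    CommutativeRing._≈_ R (Formula.lhs R n g h) (Formula.rhs R n g h)
lemma4p1 R (suc n) _ g h = begin
  three ^ n * product g + product h                 ≈⟨ +-congˡ (sym (*-identityˡ (product h))) ⟩
  three ^ n * product g + sign true * product h     ≈⟨ sym (rhsAfter-closed R false n g h) ⟩
  rhsAfter R false (suc n) g h                      ≈⟨ sym (rhs≈rhsAfter-false R (suc n) g h) ⟩
  rhs (suc n) g h                                   ∎
  where
  open CommutativeRing R
  open Formula R
  open import Algebra.Definitions.RawSemiring (Semiring.rawSemiring semiring) using (_^_; product)
  open import Relation.Binary.Reasoning.Setoid setoid
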